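{- Let $q\in\mathbb{C}$ with $0<|q|<1$, let $a,t_1,\dots,t_m\in\mathbb{C}$ with $m\ge1$, and let $$F(z)=(1-az)\prod_{i=1}^{m}(1-t_iz)=\sum_{n=0}^{m+1}a_nz^n,\qquad F_k(z)=\sum_{i=0}^{k}a_iz^i\ (k\ge0).$$ Let $g_n(q)$ ($n\ge1$) be the polynomials defined by $g_n(q)=1-\sum_{i=1}^{n-1}g_{n-i}(q)q^{(n-i)i}$. Then $$\prod_{i=1}^{m}(1-t_iz)=\sum_{n=0}^\infty \frac{c_nz^{n}}{1-azq^n}\quad\text{in }\mathbb{C}[[z]],$$ where $c_0=1$ and for $n\ge1$, $$c_n=\sum_{k=0}^{\min\{m,n-1\}} g_{n-k}(q)\,q^{(n-k)k}\,[z^{n}]\left\{\prod_{i=1}^{m}(1-t_iz)-\frac{F_k(z)}{1-az}\right\}.$$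
   Context: $[z^m]\{f(z)\}$ denotes the coefficient of $z^m$ in $f\in\mathbb{C}[[z]]$; $1/(1-az)$ and $1/(1-azq^n)$ are expanded as formal power series in $z$. -}

module Defs where

open import Algebra.Bundles using (CommutativeRing)
open import Data.Nat as ℕ using (ℕ; zero; suc; _∸_; _⊓_; _≤?_)
open import Data.Fin using (Fin)
import Data.Fin as Fin
open import Relation.Nullary using (yes; no)

module Over {c ℓ} (R : CommutativeRing c ℓ) where
  open CommutativeRing R

  infixr 8 _^_
  _^_ : Carrier → ℕ → Carrier
  x ^ zero  = 1#
  x ^ suc k = x * (x ^ k)

  ∑ : ℕ → (ℕ → Carrier) → Carrier
  ∑ zero    f = 0#
  ∑ (suc n) f = ∑ n f + f n

  -- formal power series in z: the coefficient sequence ([z^i] f = f i)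
  FPS : Set c
  FPS = ℕ → Carrier

  _⊛_ : FPS → FPS → FPS
  (f ⊛ g) N = ∑ (suc N) (λ i → f i * g (N ∸ i))

  _⊖_ : FPS → FPS → FPS
  (f ⊖ g) N = f N - g N

  oneS : FPS
  oneS zero    = 1#
  oneS (suc _) = 0#

  lin : Carrier → FPS
  lin b zero          = 1#
  lin b (suc zero)    = - b
  lin b (suc (suc _)) = 0#

  -- 1/(1 - b z) expanded as a formal power series: ∑ b^k z^k
  geom : Carrier → FPS
  geom b k = b ^ k

  shift : ℕ → FPS → FPS
  shift n f i with n ≤? i
  ... | yes _ = f (i ∸ n)
  ... | no  _ = 0#

  scale : Carrier → FPS → FPS
  scale x f i = x * f i

  prodLin : (m : ℕ) → (Fin m → Carrier) → FPS
  prodLin zero    t = oneS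
  prodLin (suc m) t = lin (t Fin.zero) ⊛ prodLin m (λ i → t (Fin.suc i))

  F : Carrier → (m : ℕ) → (Fin m → Carrier) → FPS
  F a m t = lin a ⊛ prodLin m t

  trunc : ℕ → FPS → FPS
  trunc k f i with i ≤? k
  ... | yes _ = f i
  ... | no  _ = 0#

  -- g_n(q) = 1 - ∑_{i=1}^{n-1} g_{n-i}(q) q^{(n-i) i}   (n ≥ 1),
  -- computed with fuel; g n = gAux n n.  (The value at n = 0 is unused.)
  gAux : Carrier → ℕ → ℕ → Carrier
  gAux q zero    n = 0#
  gAux q (suc f) n =
    1# - ∑ (n ∸ 1) (λ j → let i = suc j in gAux q f (n ∸ i) * q ^ ((n ∸ i) ℕ.* i))

  g : Carrier → ℕ → Carrier
  g q n = gAux q n n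

  cCoef : Carrier → Carrier → (m : ℕ) → (Fin m → Carrier) → ℕ → Carrier
  cCoef q a m t zero    = 1#
  cCoef q a m t (suc n') =
    ∑ (suc (m ⊓ n')) (λ k →
      g q (n ∸ k) * q ^ ((n ∸ k) ℕ.* k)
        * (prodLin m t ⊖ (trunc k (F a m t) ⊛ geom a)) n)
    where n = suc n'

  -- ∑_{n ≥ 0} T n, for a family with T n ∈ z^n C[[z]] (so each coefficient
  -- is a finite sum): [z^N] = ∑_{n=0}^{N} [z^N] T n
  infSum : (ℕ → FPS) → FPS
  infSum T N = ∑ (suc N) (λ n → T n N)

  rhsSeries : Carrier → Carrier → (m : ℕ) → (Fin m → Carrier) → FPS
  rhsSeries q a m t =
    infSum (λ n → scale (cCoef q a m t n) (shift n (geom (a * q ^ n))))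

-- Write P = ∏ᵢ (1 - tᵢ z) and F = (1 - a z) P, so that P = F / (1 - a z), i.e.
-- [z^N] P = ∑_{i ≤ N} Fᵢ a^(N-i).  The proof expands each monomial z^i of F:
-- with the weights  w(n,k) = g_{n-k} q^((n-k)k)  and  h(n,i) = ∑_{k<i} w(n,k),
--
--    z^i / (1 - a z) = ∑_{n ≥ i} h(n,i) a^(n-i) z^n / (1 - a z q^n)     (i ≥ 1),
--
-- which on coefficients is the identity  ∑_{j ≤ M} h(i+j,i) q^((i+j)(M-j)) = 1
-- ('monomial-identity'); it is proved by induction on i from the defining
-- recurrence of the polynomials g ('g-recurrence').  Summing over i gives, for an
-- arbitrary series f, an expansion of (f - f₀)/(1 - a z) with coefficients
-- C(n) = ∑_{i ≤ n} fᵢ h(n,i) a^(n-i)  ('expansion').  Finally the coefficient cₙ of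
-- the statement equals C(n) for f = F ('cCoef≈expansionCoeff'): the bracket [z^n]{P - F_k/(1-az)}
-- is the tail ∑_{k < i ≤ n} Fᵢ a^(n-i), and exchanging the sums over k and i turns
-- the weights w(n,k) into h(n,i).

module Submission where

open import Defs
open import Algebra.Bundles using (CommutativeRing)
open import Data.Nat using (ℕ; _≤_)
open import Data.Fin using (Fin)
import Data.Fin as Fin
open import Data.Nat as ℕ using (zero; suc; _∸_; _<_; z≤n; s≤s; _≤?_; _⊓_)
import Data.Nat.Properties as ℕₚ
open import Data.Nat.Solver using (module +-*-Solver)
open import Data.Empty using (⊥-elim)
open import Data.Sum using (inj₁; inj₂)
open import Relation.Nullary using (yes; no)
open import Relation.Binary.PropositionalEquality as ≡ using (_≡_)
import Algebra.Solver.CommutativeMonoid as CommutativeMonoidSolver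
import Algebra.Properties.CommutativeSemigroup as CommutativeSemigroupProperties
import Algebra.Properties.Ring as RingProperties
import Algebra.Properties.CommutativeSemiring.Exp as ExpProperties

exponent-split : ∀ I j r → suc j ℕ.* I ℕ.+ suc (I ℕ.+ j) ℕ.* r ≡ I ℕ.* suc (j ℕ.+ r) ℕ.+ suc j ℕ.* r
exponent-split = solve 3 (λ I j r → (con 1 :+ j) :* I :+ (con 1 :+ (I :+ j)) :* r
                               := I :* (con 1 :+ (j :+ r)) :+ (con 1 :+ j) :* r) ≡.refl
  where open +-*-Solver

beyond-min : ∀ {m n k} → m ⊓ n < k → k ≤ n → m < k
beyond-min m⊓n<k k≤n = ℕₚ.≰⇒> (λ k≤m → ℕₚ.<⇒≱ m⊓n<k (ℕₚ.⊓-glb k≤m k≤n))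

module FiniteSums {c ℓ} (R : CommutativeRing c ℓ) where
  open CommutativeRing R
  open Over R
  open CommutativeSemigroupProperties +-commutativeSemigroup using (interchange)
  open RingProperties ring using (-‿+-comm; -0#≈0#)
  open import Relation.Binary.Reasoning.Setoid setoid

  ∑-cong : ∀ n {f f′ : ℕ → Carrier} → (∀ i → i < n → f i ≈ f′ i) → ∑ n f ≈ ∑ n f′
  ∑-cong zero    eq = refl
  ∑-cong (suc n) eq = +-cong (∑-cong n (λ i i<n → eq i (ℕₚ.m<n⇒m<1+n i<n))) (eq n (ℕₚ.n<1+n n))

  ∑-vanish : ∀ n (f : ℕ → Carrier) → (∀ i → i < n → f i ≈ 0#) → ∑ n f ≈ 0#
  ∑-vanish zero    f eq = refl
  ∑-vanish (suc n) f eq =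
    trans (+-cong (∑-vanish n f (λ i i<n → eq i (ℕₚ.m<n⇒m<1+n i<n))) (eq n (ℕₚ.n<1+n n)))
          (+-identityʳ 0#)

  ∑-+ : ∀ n (f f′ : ℕ → Carrier) → ∑ n (λ i → f i + f′ i) ≈ ∑ n f + ∑ n f′
  ∑-+ zero    f f′ = sym (+-identityˡ 0#)
  ∑-+ (suc n) f f′ = trans (+-congʳ (∑-+ n f f′)) (interchange _ _ _ _)

  ∑-- : ∀ n (f f′ : ℕ → Carrier) → ∑ n (λ i → f i - f′ i) ≈ ∑ n f - ∑ n f′
  ∑-- n f f′ = begin
    ∑ n (λ i → f i - f′ i)     ≈⟨ ∑-+ n f (λ i → - f′ i) ⟩
    ∑ n f + ∑ n (λ i → - f′ i) ≈⟨ +-congˡ (negate n) ⟩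
    ∑ n f - ∑ n f′             ∎
    where
    negate : ∀ n → ∑ n (λ i → - f′ i) ≈ - ∑ n f′
    negate zero    = sym -0#≈0#
    negate (suc n) = trans (+-congʳ (negate n)) (-‿+-comm _ _)

  ∑-*ˡ : ∀ n x (f : ℕ → Carrier) → x * ∑ n f ≈ ∑ n (λ i → x * f i)
  ∑-*ˡ zero    x f = zeroʳ x
  ∑-*ˡ (suc n) x f = trans (distribˡ x _ _) (+-congʳ (∑-*ˡ n x f))

  ∑-*ʳ : ∀ n x (f : ℕ → Carrier) → ∑ n f * x ≈ ∑ n (λ i → f i * x)
  ∑-*ʳ n x f = trans (*-comm _ x) (trans (∑-*ˡ n x f) (∑-cong n (λ i _ → *-comm x (f i))))

  ∑-head : ∀ n (f : ℕ → Carrier) → ∑ (suc n) f ≈ f 0 + ∑ n (λ i → f (suc i))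
  ∑-head zero    f = +-comm 0# (f 0)
  ∑-head (suc n) f = trans (+-congʳ (∑-head n f)) (+-assoc _ _ _)

  ∑-tail : ∀ {K} n (f : ℕ → Carrier) → K ≤ n → (∀ i → K ≤ i → i < n → f i ≈ 0#) → ∑ n f ≈ ∑ K f
  ∑-tail zero    f z≤n       eq = refl
  ∑-tail (suc n) f K≤1+n eq with ℕₚ.m≤n⇒m<n∨m≡n K≤1+n
  ... | inj₂ ≡.refl    = refl
  ... | inj₁ (s≤s K≤n) =
    trans (+-cong (∑-tail n f K≤n (λ i K≤i i<n → eq i K≤i (ℕₚ.m<n⇒m<1+n i<n)))
                  (eq n K≤n (ℕₚ.n<1+n n)))
          (+-identityʳ _)

  ∑-swap : ∀ A B (φ : ℕ → ℕ → Carrier) → ∑ A (λ x → ∑ B (φ x)) ≈ ∑ B (λ y → ∑ A (λ x → φ x y))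
  ∑-swap zero    B φ = sym (∑-vanish B _ (λ _ _ → refl))
  ∑-swap (suc A) B φ = trans (+-congʳ (∑-swap A B φ)) (sym (∑-+ B (λ y → ∑ A (λ x → φ x y)) (φ A)))

  ∑-reverse : ∀ M (f : ℕ → Carrier) → ∑ M f ≈ ∑ M (λ j → f (M ∸ suc j))
  ∑-reverse zero    f = refl
  ∑-reverse (suc M) f = begin
    ∑ M f + f M                         ≈⟨ +-congʳ (∑-reverse M f) ⟩
    ∑ M (λ j → f (M ∸ suc j)) + f M     ≈⟨ +-comm _ _ ⟩
    f M + ∑ M (λ j → f (M ∸ suc j))     ≈⟨ sym (∑-head M (λ j → f (suc M ∸ suc j))) ⟩
    ∑ (suc M) (λ j → f (suc M ∸ suc j)) ∎

  ∑-triangle : ∀ M (φ : ℕ → ℕ → Carrier) →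
    ∑ M (λ n → ∑ (suc n) (φ n)) ≈ ∑ M (λ i → ∑ (M ∸ i) (λ j → φ (i ℕ.+ j) i))
  ∑-triangle zero    φ = refl
  ∑-triangle (suc M) φ = begin
    ∑ M (λ n → ∑ (suc n) (φ n)) + (∑ M (φ M) + φ M M)
      ≈⟨ trans (+-congʳ (∑-triangle M φ)) (sym (+-assoc _ _ _)) ⟩
    (∑ M rows + ∑ M (φ M)) + φ M M
      ≈⟨ +-cong (sym (∑-+ M rows (φ M)))
                (trans (reflexive (≡.cong (λ n → φ n M) (≡.sym (ℕₚ.+-identityʳ M)))) (sym (+-identityˡ _))) ⟩
    ∑ M (λ i → rows i + φ M i) + ∑ 1 (λ j → φ (M ℕ.+ j) M)
      ≈⟨ +-cong (∑-cong M (λ i i<M → extend i (ℕₚ.<⇒≤ i<M)))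
                (reflexive (≡.cong (λ d → ∑ d (λ j → φ (M ℕ.+ j) M)) (≡.sym (ℕₚ.m+n∸n≡m 1 M)))) ⟩
    ∑ M (λ i → ∑ (suc M ∸ i) (λ j → φ (i ℕ.+ j) i)) + ∑ (suc M ∸ M) (λ j → φ (M ℕ.+ j) M) ∎
    where
    rows : ℕ → Carrier
    rows i = ∑ (M ∸ i) (λ j → φ (i ℕ.+ j) i)
    extend : ∀ i → i ≤ M → rows i + φ M i ≈ ∑ (suc M ∸ i) (λ j → φ (i ℕ.+ j) i)
    extend i i≤M rewrite ℕₚ.+-∸-assoc 1 i≤M =
      +-congˡ (reflexive (≡.cong (λ n → φ n i) (≡.sym (ℕₚ.m+[n∸m]≡n i≤M))))

module Powers {c ℓ} (R : CommutativeRing c ℓ) where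
  open CommutativeRing R
  open Over R
  private
    module Lib = ExpProperties commutativeSemiring

  ^≈lib : ∀ x n → x ^ n ≈ x Lib.^ n
  ^≈lib x zero    = refl
  ^≈lib x (suc n) = *-congˡ (^≈lib x n)

  ^-congˡ : ∀ {x y} n → x ≈ y → x ^ n ≈ y ^ n
  ^-congˡ {x} {y} n x≈y = trans (^≈lib x n) (trans (Lib.^-congˡ n x≈y) (sym (^≈lib y n)))

  ^-congʳ : ∀ x {m n} → m ≡ n → x ^ m ≈ x ^ n
  ^-congʳ x m≡n = reflexive (≡.cong (x ^_) m≡n)

  ^-+ : ∀ x m n → x ^ (m ℕ.+ n) ≈ x ^ m * x ^ n
  ^-+ x m n = trans (^≈lib x (m ℕ.+ n))
    (trans (Lib.^-homo-* x m n) (sym (*-cong (^≈lib x m) (^≈lib x n))))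

  ^-* : ∀ x m n → x ^ (m ℕ.* n) ≈ (x ^ m) ^ n
  ^-* x m n = trans (^≈lib x (m ℕ.* n))
    (sym (trans (^≈lib (x ^ m) n) (trans (Lib.^-congˡ n (^≈lib x m)) (Lib.^-assocʳ x m n))))

  ^-distrib-* : ∀ x y n → (x * y) ^ n ≈ x ^ n * y ^ n
  ^-distrib-* x y n = trans (^≈lib (x * y) n)
    (trans (Lib.^-distrib-* x y n) (sym (*-cong (^≈lib x n) (^≈lib y n))))

module Series {c ℓ} (R : CommutativeRing c ℓ) where
  open CommutativeRing R
  open Over R
  open FiniteSums R
  open Powers R
  open RingProperties ring using (-‿distribˡ-*; -0#≈0#; xyx⁻¹≈y)
  open CommutativeSemigroupProperties *-commutativeSemigroup using (x∙yz≈y∙xz)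
  open import Relation.Binary.Reasoning.Setoid setoid

  DegreeAtMost : ℕ → FPS → Set ℓ
  DegreeAtMost d f = ∀ i → d < i → f i ≈ 0#

  lin⊛-zero : ∀ b f → (lin b ⊛ f) 0 ≈ f 0
  lin⊛-zero b f = trans (+-identityˡ _) (*-identityˡ _)

  lin⊛-suc : ∀ b f i → (lin b ⊛ f) (suc i) ≈ f (suc i) - b * f i
  lin⊛-suc b f i = begin
    (lin b ⊛ f) (suc i)
      ≈⟨ ∑-head (suc i) _ ⟩
    1# * f (suc i) + ∑ (suc i) (λ j → lin b (suc j) * f (i ∸ j))
      ≈⟨ +-cong (*-identityˡ _) (∑-head i _) ⟩
    f (suc i) + (- b * f i + ∑ i (λ j → 0# * f (i ∸ suc j)))
      ≈⟨ +-congˡ (+-cong (sym (-‿distribˡ-* b (f i))) (∑-vanish i _ (λ j _ → zeroˡ _))) ⟩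
    f (suc i) + (- (b * f i) + 0#)
      ≈⟨ +-congˡ (+-identityʳ _) ⟩
    f (suc i) - b * f i ∎

  lin⊛-degree : ∀ b f d → DegreeAtMost d f → DegreeAtMost (suc d) (lin b ⊛ f)
  lin⊛-degree b f d deg (suc i) (s≤s d<i) = begin
    (lin b ⊛ f) (suc i)    ≈⟨ lin⊛-suc b f i ⟩
    f (suc i) - b * f i    ≈⟨ +-cong (deg (suc i) (ℕₚ.m<n⇒m<1+n d<i)) (-‿cong (*-congˡ (deg i d<i))) ⟩
    0# - b * 0#            ≈⟨ +-identityˡ _ ⟩
    - (b * 0#)             ≈⟨ -‿cong (zeroʳ b) ⟩
    - 0#                   ≈⟨ -0#≈0# ⟩
    0#                     ∎

  divide-lin : ∀ b f n → ((lin b ⊛ f) ⊛ geom b) n ≈ f n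
  divide-lin b f zero    = trans (+-identityˡ _) (trans (*-identityʳ _) (lin⊛-zero b f))
  divide-lin b f (suc n) = begin
    ∑ (suc n) (λ i → G i * b ^ (suc n ∸ i)) + G (suc n) * b ^ (n ∸ n)
      ≈⟨ +-cong (∑-cong (suc n) pull-b) (trans (*-congˡ (^-congʳ b (ℕₚ.n∸n≡0 n))) (*-identityʳ _)) ⟩
    ∑ (suc n) (λ i → b * (G i * b ^ (n ∸ i))) + G (suc n)
      ≈⟨ +-cong (trans (sym (∑-*ˡ (suc n) b _)) (*-congˡ (divide-lin b f n))) (lin⊛-suc b f n) ⟩
    b * f n + (f (suc n) - b * f n)
      ≈⟨ trans (sym (+-assoc _ _ _)) (xyx⁻¹≈y _ _) ⟩
    f (suc n) ∎
    where
    G : FPS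
    G = lin b ⊛ f
    pull-b : ∀ i → i < suc n → G i * b ^ (suc n ∸ i) ≈ b * (G i * b ^ (n ∸ i))
    pull-b i (s≤s i≤n) = trans (*-congˡ (^-congʳ b (ℕₚ.+-∸-assoc 1 i≤n))) (x∙yz≈y∙xz (G i) b _)

  ⊖-⊛ : ∀ f f′ h n → ((f ⊖ f′) ⊛ h) n ≈ (f ⊛ h) n - (f′ ⊛ h) n
  ⊖-⊛ f f′ h n = trans (∑-cong (suc n) (λ i _ → trans (distribʳ _ _ _) (+-congˡ (sym (-‿distribˡ-* _ _)))))
                       (∑-- (suc n) _ _)

  shift-coeff : ∀ n f i → n ≤ i → shift n f i ≈ f (i ∸ n)
  shift-coeff n f i n≤i with n ≤? i
  ... | yes _   = refl
  ... | no  n≰i = ⊥-elim (n≰i n≤i)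

  trunc-kept : ∀ {k i} f → i ≤ k → trunc k f i ≈ f i
  trunc-kept {k} {i} f i≤k with i ≤? k
  ... | yes _   = refl
  ... | no  i≰k = ⊥-elim (i≰k i≤k)

  trunc-dropped : ∀ {k i} f → k < i → trunc k f i ≈ 0#
  trunc-dropped {k} {i} f k<i with i ≤? k
  ... | yes i≤k = ⊥-elim (ℕₚ.<⇒≱ k<i i≤k)
  ... | no  _   = refl

  tail-kept : ∀ {k i} f → k < i → (f ⊖ trunc k f) i ≈ f i
  tail-kept f k<i = trans (+-congˡ (trans (-‿cong (trunc-dropped f k<i)) -0#≈0#)) (+-identityʳ _)

  tail-dropped : ∀ {k i} f → i ≤ k → (f ⊖ trunc k f) i ≈ 0#
  tail-dropped f i≤k = trans (+-congˡ (-‿cong (trunc-kept f i≤k))) (-‿inverseʳ _)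

  tail-vanishes : ∀ f {d k} → DegreeAtMost d f → d ≤ k → ∀ i → (f ⊖ trunc k f) i ≈ 0#
  tail-vanishes f {d} {k} deg d≤k i with k ℕ.<? i
  ... | yes k<i = trans (tail-kept f k<i) (deg i (ℕₚ.≤-<-trans d≤k k<i))
  ... | no  k≮i = tail-dropped f (ℕₚ.≮⇒≥ k≮i)

  prodLin-zero : ∀ m t → prodLin m t 0 ≈ 1#
  prodLin-zero zero    t = refl
  prodLin-zero (suc m) t = trans (lin⊛-zero (t Fin.zero) (prodLin m t′)) (prodLin-zero m t′)
    where
    t′ : Fin m → Carrier
    t′ i = t (Fin.suc i)

  prodLin-degree : ∀ m t → DegreeAtMost m (prodLin m t)
  prodLin-degree zero    t (suc i) _   = refl
  prodLin-degree (suc m) t i     m<i = lin⊛-degree (t Fin.zero) (prodLin m t′) m (prodLin-degree m t′) i m<i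
    where
    t′ : Fin m → Carrier
    t′ i = t (Fin.suc i)

module Weights {c ℓ} (R : CommutativeRing c ℓ) (q : CommutativeRing.Carrier R) where
  open CommutativeRing R
  open Over R
  open RingProperties ring using (xyx⁻¹≈y)
  open CommutativeSemigroupProperties *-commutativeSemigroup using (x∙yz≈y∙xz)
  open FiniteSums R
  open Powers R
  open import Relation.Binary.Reasoning.Setoid setoid

  gAux-fuel : ∀ f f′ n → 1 ≤ n → n ≤ f → n ≤ f′ → gAux q f n ≈ gAux q f′ n
  gAux-fuel (suc f) (suc f′) (suc n) _ (s≤s n≤f) (s≤s n≤f′) =
    +-congˡ (-‿cong (∑-cong n (λ j j<n → *-congʳ
      (gAux-fuel f f′ (n ∸ j) (ℕₚ.m<n⇒0<n∸m j<n)
                 (ℕₚ.≤-trans (ℕₚ.m∸n≤m n j) n≤f) (ℕₚ.≤-trans (ℕₚ.m∸n≤m n j) n≤f′)))))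

  g-recurrence : ∀ M → ∑ (suc M) (λ j → g q (suc j) * q ^ (suc j ℕ.* (M ∸ j))) ≈ 1#
  g-recurrence M = begin
    earlier + g q (suc M) * q ^ (suc M ℕ.* (M ∸ M))
      ≈⟨ +-congˡ (trans (*-congˡ (^-congʳ q exponent-zero)) (*-identityʳ _)) ⟩
    earlier + (1# - unfolded)
      ≈⟨ +-congˡ (+-congˡ (-‿cong unfolded≈earlier)) ⟩
    earlier + (1# - earlier)
      ≈⟨ trans (sym (+-assoc _ _ _)) (xyx⁻¹≈y _ _) ⟩
    1# ∎
    where
    earlier unfolded : Carrier
    earlier  = ∑ M (λ j → g q (suc j) * q ^ (suc j ℕ.* (M ∸ j)))
    unfolded = ∑ M (λ j → gAux q M (M ∸ j) * q ^ ((M ∸ j) ℕ.* suc j))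
    exponent-zero : suc M ℕ.* (M ∸ M) ≡ 0
    exponent-zero = ≡.trans (≡.cong (suc M ℕ.*_) (ℕₚ.n∸n≡0 M)) (ℕₚ.*-zeroʳ (suc M))
    -- the recurrence lists the same terms in the opposite order
    unfolded≈earlier : unfolded ≈ earlier
    unfolded≈earlier = trans (∑-reverse M _) (∑-cong M λ j j<M →
      trans (reflexive (≡.cong₂ (λ u v → gAux q M u * q ^ (u ℕ.* v))
                                (ℕₚ.m∸[m∸n]≡n j<M) (≡.sym (ℕₚ.+-∸-assoc 1 j<M))))
            (*-congʳ (gAux-fuel M (suc j) (suc j) (s≤s z≤n) j<M ℕₚ.≤-refl)))

  weight : ℕ → ℕ → Carrier
  weight n k = g q (n ∸ k) * q ^ ((n ∸ k) ℕ.* k)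

  weightSum : ℕ → ℕ → Carrier
  weightSum n i = ∑ i (weight n)

  -- the full weight sum h(n,n) is the recurrence of g in reverse order
  weightSum-diagonal : ∀ M → weightSum (suc M) (suc M) ≈ 1#
  weightSum-diagonal M = trans (∑-reverse (suc M) _)
    (trans (∑-cong (suc M) (λ j j<1+M →
              reflexive (≡.cong (λ u → g q u * q ^ (u ℕ.* (M ∸ j))) (index j (ℕₚ.≤-pred j<1+M)))))
           (g-recurrence M))
    where
    index : ∀ j → j ≤ M → suc M ∸ (M ∸ j) ≡ suc j
    index j j≤M = ≡.trans (ℕₚ.+-∸-assoc 1 (ℕₚ.m∸n≤m M j)) (≡.cong suc (ℕₚ.m∸[m∸n]≡n j≤M))

  -- a^(-i) times [z^(i+M)] of ∑_{n ≥ i} h(n,i) a^(n-i) z^n / (1 - a z q^n)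
  monomialSum : ℕ → ℕ → Carrier
  monomialSum i M = ∑ (suc M) (λ j → weightSum (i ℕ.+ j) i * q ^ ((i ℕ.+ j) ℕ.* (M ∸ j)))

  -- the constant term is not expanded: h(n,0) = 0
  monomialSum-zero : ∀ M → monomialSum 0 M ≈ 0#
  monomialSum-zero M = ∑-vanish (suc M) _ (λ j _ → zeroˡ _)

  -- for z: h(1+j,1) = g_(1+j), so this is the recurrence of g
  monomialSum-one : ∀ M → monomialSum 1 M ≈ 1#
  monomialSum-one M = trans (∑-cong (suc M) (λ j _ → *-congʳ (h≈g j))) (g-recurrence M)
    where
    h≈g : ∀ j → weightSum (suc j) 1 ≈ g q (suc j)
    h≈g j = trans (+-identityˡ _) (trans (*-congˡ (^-congʳ q (ℕₚ.*-zeroʳ (suc j)))) (*-identityʳ _))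

  -- passing from z^I to z^(I+1) trades one power of z for one more coefficient
  monomialSum-shift : ∀ i M → monomialSum (suc (suc i)) M ≈ monomialSum (suc i) (suc M)
  monomialSum-shift i M = begin
    monomialSum (suc I) M
      ≈⟨ ∑-cong (suc M) (λ j j<1+M → trans (distribʳ _ _ _) (+-congˡ (new-term j (ℕₚ.≤-pred j<1+M)))) ⟩
    ∑ (suc M) (λ j → old j + Y * recurrenceTerm j)
      ≈⟨ ∑-+ (suc M) old _ ⟩
    ∑ (suc M) old + ∑ (suc M) (λ j → Y * recurrenceTerm j)
      ≈⟨ +-congˡ (trans (sym (∑-*ˡ (suc M) Y _)) (trans (*-congˡ (g-recurrence M)) (*-identityʳ Y))) ⟩
    ∑ (suc M) old + Y
      ≈⟨ +-comm _ _ ⟩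
    Y + ∑ (suc M) old
      ≈⟨ sym (trans (∑-head (suc M) _) (+-cong first-term (∑-cong (suc M) (λ j _ → reflexive (≡.cong
               (λ n → weightSum n I * q ^ (n ℕ.* (M ∸ j))) (ℕₚ.+-suc I j)))))) ⟩
    monomialSum I (suc M) ∎
    where
    I : ℕ
    I = suc i
    Y : Carrier
    Y = q ^ (I ℕ.* suc M)
    old recurrenceTerm : ℕ → Carrier
    old j = weightSum (suc (I ℕ.+ j)) I * q ^ (suc (I ℕ.+ j) ℕ.* (M ∸ j))
    recurrenceTerm j = g q (suc j) * q ^ (suc j ℕ.* (M ∸ j))
    first-term : weightSum (I ℕ.+ 0) I * q ^ ((I ℕ.+ 0) ℕ.* suc M) ≈ Y
    first-term = trans (reflexive (≡.cong (λ n → weightSum n I * q ^ (n ℕ.* suc M)) (ℕₚ.+-identityʳ I)))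
                       (trans (*-congʳ (weightSum-diagonal i)) (*-identityˡ Y))
    new-term : ∀ j → j ≤ M → weight (suc (I ℕ.+ j)) I * q ^ (suc (I ℕ.+ j) ℕ.* (M ∸ j)) ≈ Y * recurrenceTerm j
    new-term j j≤M = begin
      g q (suc (I ℕ.+ j) ∸ I) * q ^ ((suc (I ℕ.+ j) ∸ I) ℕ.* I) * q ^ (suc (I ℕ.+ j) ℕ.* (M ∸ j))
        ≈⟨ reflexive (≡.cong (λ u → g q u * q ^ (u ℕ.* I) * q ^ (suc (I ℕ.+ j) ℕ.* (M ∸ j))) index) ⟩
      g q (suc j) * q ^ (suc j ℕ.* I) * q ^ (suc (I ℕ.+ j) ℕ.* (M ∸ j))
        ≈⟨ trans (*-assoc _ _ _) (*-congˡ (sym (^-+ q (suc j ℕ.* I) _))) ⟩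
      g q (suc j) * q ^ (suc j ℕ.* I ℕ.+ suc (I ℕ.+ j) ℕ.* (M ∸ j))
        ≈⟨ *-congˡ (^-congʳ q exponent) ⟩
      g q (suc j) * q ^ (I ℕ.* suc M ℕ.+ suc j ℕ.* (M ∸ j))
        ≈⟨ trans (*-congˡ (^-+ q (I ℕ.* suc M) _)) (x∙yz≈y∙xz _ _ _) ⟩
      Y * recurrenceTerm j ∎
      where
      index : suc (I ℕ.+ j) ∸ I ≡ suc j
      index = ≡.trans (≡.cong (_∸ I) (≡.sym (ℕₚ.+-suc I j))) (ℕₚ.m+n∸m≡n I (suc j))
      exponent : suc j ℕ.* I ℕ.+ suc (I ℕ.+ j) ℕ.* (M ∸ j) ≡ I ℕ.* suc M ℕ.+ suc j ℕ.* (M ∸ j)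
      exponent = ≡.trans (exponent-split I j (M ∸ j))
                         (≡.cong (λ u → I ℕ.* suc u ℕ.+ suc j ℕ.* (M ∸ j)) (ℕₚ.m+[n∸m]≡n j≤M))

  monomial-identity : ∀ i M → monomialSum (suc i) M ≈ 1#
  monomial-identity zero    M = monomialSum-one M
  monomial-identity (suc i) M = trans (monomialSum-shift i M) (monomial-identity i (suc M))

module Expansion {c ℓ} (R : CommutativeRing c ℓ) (q a : CommutativeRing.Carrier R) where
  open CommutativeRing R
  open Over R
  open FiniteSums R
  open Powers R
  open Weights R q
  module *-Solver = CommutativeMonoidSolver *-commutativeMonoid
  open import Relation.Binary.Reasoning.Setoid setoid

  expansionCoeff : FPS → ℕ → Carrier
  expansionCoeff f n = ∑ (suc n) (λ i → f i * weightSum n i * a ^ (n ∸ i))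

  expansionCoeff-zero : ∀ f → expansionCoeff f 0 ≈ 0#
  expansionCoeff-zero f = trans (+-identityˡ _) (trans (*-congʳ (zeroʳ (f 0))) (zeroˡ _))

  -- [z^N] z^n/(1 - a z q^n) for n ≤ N
  basis : ℕ → ℕ → Carrier
  basis N n = (a * q ^ n) ^ (N ∸ n)

  -- ∑_{n ≥ 0} C(n) z^n/(1 - a z q^n) = (f - f₀)/(1 - a z), compared at z^N
  expansion : ∀ f N →
    ∑ (suc N) (λ n → expansionCoeff f n * basis N n) ≈ ∑ N (λ i → f (suc i) * a ^ (N ∸ suc i))
  expansion f N = begin
    ∑ (suc N) (λ n → expansionCoeff f n * basis N n)
      ≈⟨ ∑-cong (suc N) (λ n _ → ∑-*ʳ (suc n) (basis N n) _) ⟩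
    ∑ (suc N) (λ n → ∑ (suc n) (term n))
      ≈⟨ ∑-triangle (suc N) term ⟩
    ∑ (suc N) (λ i → ∑ (suc N ∸ i) (λ j → term (i ℕ.+ j) i))
      ≈⟨ ∑-cong (suc N) (λ i i<1+N → column i (ℕₚ.≤-pred i<1+N)) ⟩
    ∑ (suc N) (λ i → f i * a ^ (N ∸ i) * monomialSum i (N ∸ i))
      ≈⟨ ∑-head N _ ⟩
    f 0 * a ^ N * monomialSum 0 N
      + ∑ N (λ i → f (suc i) * a ^ (N ∸ suc i) * monomialSum (suc i) (N ∸ suc i))
      ≈⟨ +-cong (trans (*-congˡ (monomialSum-zero N)) (zeroʳ _))
                (∑-cong N (λ i _ → trans (*-congˡ (monomial-identity i _)) (*-identityʳ _))) ⟩
    0# + ∑ N (λ i → f (suc i) * a ^ (N ∸ suc i))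
      ≈⟨ +-identityˡ _ ⟩
    ∑ N (λ i → f (suc i) * a ^ (N ∸ suc i)) ∎
    where
    term : ℕ → ℕ → Carrier
    term n i = f i * weightSum n i * a ^ (n ∸ i) * basis N n
    column : ∀ i → i ≤ N → ∑ (suc N ∸ i) (λ j → term (i ℕ.+ j) i) ≈ f i * a ^ (N ∸ i) * monomialSum i (N ∸ i)
    column i i≤N rewrite ℕₚ.+-∸-assoc 1 i≤N =
      trans (∑-cong (suc M) (λ j j<1+M → regroup j (ℕₚ.≤-pred j<1+M))) (sym (∑-*ˡ (suc M) _ _))
      where
      M : ℕ
      M = N ∸ i
      regroup : ∀ j → j ≤ M →
        term (i ℕ.+ j) i ≈ f i * a ^ M * (weightSum (i ℕ.+ j) i * q ^ ((i ℕ.+ j) ℕ.* (M ∸ j)))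
      regroup j j≤M = begin
        f i * weightSum (i ℕ.+ j) i * a ^ (i ℕ.+ j ∸ i) * (a * q ^ (i ℕ.+ j)) ^ (N ∸ (i ℕ.+ j))
          ≈⟨ *-cong (*-congˡ (^-congʳ a (ℕₚ.m+n∸m≡n i j)))
                    (reflexive (≡.cong ((a * q ^ (i ℕ.+ j)) ^_) (≡.sym (ℕₚ.∸-+-assoc N i j)))) ⟩
        f i * W * a ^ j * (a * q ^ (i ℕ.+ j)) ^ (M ∸ j)
          ≈⟨ *-congˡ (trans (^-distrib-* a _ (M ∸ j)) (*-congˡ (sym (^-* q (i ℕ.+ j) (M ∸ j))))) ⟩
        f i * W * a ^ j * (a ^ (M ∸ j) * Q)
          ≈⟨ *-Solver.solve 5 (λ F W A B Q → ((F ⊕ W) ⊕ A) ⊕ (B ⊕ Q) ⊜ (F ⊕ (A ⊕ B)) ⊕ (W ⊕ Q)) refl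
               (f i) W (a ^ j) (a ^ (M ∸ j)) Q ⟩
        f i * (a ^ j * a ^ (M ∸ j)) * (W * Q)
          ≈⟨ *-congʳ (*-congˡ (trans (sym (^-+ a j (M ∸ j))) (^-congʳ a (ℕₚ.m+[n∸m]≡n j≤M)))) ⟩
        f i * a ^ M * (W * Q) ∎
        where
        open *-Solver using (_⊕_; _⊜_)
        W Q : Carrier
        W = weightSum (i ℕ.+ j) i
        Q = q ^ ((i ℕ.+ j) ℕ.* (M ∸ j))

module Coefficients {c ℓ} (R : CommutativeRing c ℓ) (q a : CommutativeRing.Carrier R)
                    (m : ℕ) (t : Fin m → CommutativeRing.Carrier R) where
  open CommutativeRing R
  open Over R
  open FiniteSums R
  open Series R
  open Weights R q
  open Expansion R q a
  open import Relation.Binary.Reasoning.Setoid setoid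

  F-degree : DegreeAtMost (suc m) (F a m t)
  F-degree = lin⊛-degree a (prodLin m t) m (prodLin-degree m t)

  -- [z^n]{P - F_k/(1 - a z)} is [z^n] of (F - F_k)/(1 - a z), since P = F/(1 - a z)
  bracket≈tail : ∀ k n →
    (prodLin m t ⊖ (trunc k (F a m t) ⊛ geom a)) n ≈ ((F a m t ⊖ trunc k (F a m t)) ⊛ geom a) n
  bracket≈tail k n = sym (trans (⊖-⊛ (F a m t) _ (geom a) n) (+-congʳ (divide-lin a (prodLin m t) n)))

  weighted-tails : ∀ f n i → i ≤ n → ∑ n (λ k → weight n k * (f ⊖ trunc k f) i) ≈ f i * weightSum n i
  weighted-tails f n i i≤n = begin
    ∑ n (λ k → weight n k * (f ⊖ trunc k f) i)
      ≈⟨ ∑-tail n _ i≤n (λ k i≤k _ → trans (*-congˡ (tail-dropped f i≤k)) (zeroʳ _)) ⟩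
    ∑ i (λ k → weight n k * (f ⊖ trunc k f) i)
      ≈⟨ ∑-cong i (λ k k<i → *-congˡ (tail-kept f k<i)) ⟩
    ∑ i (λ k → weight n k * f i)
      ≈⟨ sym (∑-*ʳ i (f i) (weight n)) ⟩
    weightSum n i * f i
      ≈⟨ *-comm _ _ ⟩
    f i * weightSum n i ∎

  -- cₙ = C(n) for n ≥ 1: rewrite each bracket as a tail of F, extend the range of k
  -- to k < n (the tails beyond z^(m+1) vanish), and exchange the sums over k and i
  cCoef≈expansionCoeff : ∀ n′ → cCoef q a m t (suc n′) ≈ expansionCoeff (F a m t) (suc n′)
  cCoef≈expansionCoeff n′ = begin
    ∑ (suc (m ⊓ n′)) (λ k → weight n k * (prodLin m t ⊖ (trunc k (F a m t) ⊛ geom a)) n)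
      ≈⟨ ∑-cong (suc (m ⊓ n′)) (λ k _ → *-congˡ (bracket≈tail k n)) ⟩
    ∑ (suc (m ⊓ n′)) (λ k → weight n k * tailTerm k)
      ≈⟨ sym (∑-tail n _ (s≤s (ℕₚ.m⊓n≤n m n′)) (λ k m⊓n′<k k<n →
               trans (*-congˡ (tail-beyond-m k (beyond-min m⊓n′<k (ℕₚ.≤-pred k<n)))) (zeroʳ _))) ⟩
    ∑ n (λ k → weight n k * tailTerm k)
      ≈⟨ ∑-cong n (λ k _ → ∑-*ˡ (suc n) (weight n k) _) ⟩
    ∑ n (λ k → ∑ (suc n) (λ i → weight n k * ((F a m t ⊖ trunc k (F a m t)) i * a ^ (n ∸ i))))
      ≈⟨ ∑-swap n (suc n) _ ⟩
    ∑ (suc n) (λ i → ∑ n (λ k → weight n k * ((F a m t ⊖ trunc k (F a m t)) i * a ^ (n ∸ i))))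
      ≈⟨ ∑-cong (suc n) (λ i i<1+n → trans (∑-cong n (λ k _ → sym (*-assoc _ _ _)))
                                     (trans (sym (∑-*ʳ n _ _))
                                            (*-congʳ (weighted-tails (F a m t) n i (ℕₚ.≤-pred i<1+n))))) ⟩
    expansionCoeff (F a m t) n ∎
    where
    n : ℕ
    n = suc n′
    tailTerm : ℕ → Carrier
    tailTerm k = ((F a m t ⊖ trunc k (F a m t)) ⊛ geom a) n
    tail-beyond-m : ∀ k → m < k → tailTerm k ≈ 0#
    tail-beyond-m k m<k = ∑-vanish (suc n) _ (λ i _ →
      trans (*-congʳ (tail-vanishes (F a m t) F-degree m<k i)) (zeroˡ _))

corollary2p5 : ∀ {c ℓ} (R : CommutativeRing c ℓ) →
    let open CommutativeRing R in
    let open Defs.Over R in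
    (q a : Carrier) (m : ℕ) → 1 ≤ m → (t : Fin m → Carrier) →
    ∀ (N : ℕ) → prodLin m t N ≈ rhsSeries q a m t N
corollary2p5 R q a m _ t N = begin
  prodLin m t N
    ≈⟨ sym (divide-lin a (prodLin m t) N) ⟩
  ∑ (suc N) (λ i → F a m t i * a ^ (N ∸ i))
    ≈⟨ ∑-head N _ ⟩
  F a m t 0 * a ^ N + ∑ N (λ i → F a m t (suc i) * a ^ (N ∸ suc i))
    ≈⟨ +-cong leading (sym (expansion (F a m t) N)) ⟩
  1# * basis N 0 + ∑ (suc N) (λ n → expansionCoeff (F a m t) n * basis N n)
    ≈⟨ +-congˡ (trans (∑-head N _) (trans (+-congʳ (trans (*-congʳ (expansionCoeff-zero (F a m t))) (zeroˡ _)))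
                                          (+-identityˡ _))) ⟩
  1# * basis N 0 + ∑ N (λ n → expansionCoeff (F a m t) (suc n) * basis N (suc n))
    ≈⟨ sym (trans (∑-head N _) (+-congˡ (∑-cong N (λ n _ → *-congʳ (cCoef≈expansionCoeff n))))) ⟩
  ∑ (suc N) (λ n → cCoef q a m t n * basis N n)
    ≈⟨ ∑-cong (suc N) (λ n n<1+N → *-congˡ (sym (shift-coeff n _ N (ℕₚ.≤-pred n<1+N)))) ⟩
  rhsSeries q a m t N ∎
  where
  open CommutativeRing R
  open Over R
  open FiniteSums R
  open Powers R
  open Series R
  open Expansion R q a
  open Coefficients R q a m t
  open import Relation.Binary.Reasoning.Setoid setoid
  -- F₀ = 1 and q⁰ = 1
  leading : F a m t 0 * a ^ N ≈ 1# * basis N 0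
  leading = *-cong (trans (lin⊛-zero a (prodLin m t)) (prodLin-zero m t)) (^-congˡ N (sym (*-identityʳ a)))
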